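{- Let $p$ be a prime and let $\ell \geq 2$ be an integer. Then for all integers $n \geq 0$ and every $r \in \{1,2,\ldots,p-1\}$, \[ T_{\ell,p}(pn+r) \equiv 0 \pmod p . \]
   Context: For integers $\ell>1$ and $k\geq 1$, a partition is $\ell$-regular if none of its parts is divisible by $\ell$. A $k$-tuple $\ell$-regular partition of $n$ is a $k$-tuple $(\xi_1,\ldots,\xi_k)$ of $\ell$-regular partitions whose sizes sum to $n$. $T_{\ell,k}(n)$ denotes the number of such $k$-tuples, so that \[ \sum_{n\geq 0} T_{\ell,k}(n)q^n=\prod_{i\geq 1}\frac{(1-q^{\ell i})^k}{(1-q^i)^k}. \] -}

module Defs where

open import Data.Nat using (ℕ; zero; suc; _+_; _*_; _∸_; _≤?_)
open import Data.Nat.Divisibility using (_∣?_)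
open import Data.List using (List; map; upTo)
open import Data.Nat.ListAction using (sum)
open import Relation.Nullary using (yes; no)

Σ≤ : ℕ → (ℕ → ℕ) → ℕ
Σ≤ n f = sum (map f (upTo (suc n)))

-- regCount ℓ m n : number of partitions of n all of whose parts lie in
-- {1,…,m} and are not divisible by ℓ.
regCount : ℕ → ℕ → ℕ → ℕ
regCount ℓ zero zero = 1
regCount ℓ zero (suc n) = 0
regCount ℓ (suc m) n with ℓ ∣? suc m
... | yes _ = regCount ℓ m n
... | no _ = Σ≤ n (λ j → mult j)
  where
  mult : ℕ → ℕ
  mult j with j * suc m ≤? n
  ... | yes _ = regCount ℓ m (n ∸ j * suc m)
  ... | no _ = 0

-- number of ℓ-regular partitions of n (parts never exceed n)
reg : ℕ → ℕ → ℕ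
reg ℓ n = regCount ℓ n n

-- T ℓ k n : number of k-tuples of ℓ-regular partitions with sizes summing to n
T : ℕ → ℕ → ℕ → ℕ
T ℓ zero zero = 1
T ℓ zero (suc n) = 0
T ℓ (suc k) n = Σ≤ n (λ i → reg ℓ i * T ℓ k (n ∸ i))

-- Let F(q) = Σ reg ℓ n qⁿ, so that T ℓ p n is the n-th coefficient of Fᵖ. The Euler
-- operator θ = q d/dq is a derivation, hence θ(Fᵖ) = p · θF · Fᵖ⁻¹ and comparing
-- coefficients gives n · T ℓ p n ≡ p · cₙ for some natural cₙ. When p ∤ n, Euclid's
-- lemma leaves p ∣ T ℓ p n. The argument works for the p-th power of any series with
-- natural coefficients, so the hypothesis ℓ ≥ 2 is not needed.
module Submission where

open import Defs
open import Data.Nat using (ℕ; zero; suc; _+_; _*_; _∸_; _≤_; _<_; >-nonZero)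
open import Data.Nat.Properties
open import Data.Nat.Divisibility using (_∣_; divides; ∣m+n∣m⇒∣n; m∣m*n; >⇒∤)
open import Data.Nat.Primality using (Prime; euclidsLemma)
open import Data.Nat.ListAction using (sum)
open import Data.Nat.Solver using (module +-*-Solver)
open import Algebra.Properties.CommutativeSemigroup +-commutativeSemigroup
  using () renaming (interchange to +-interchange)
open import Data.List using (applyUpTo)
open import Data.List.Properties using (map-upTo)
open import Data.Sum using (inj₁; inj₂)
open import Data.Empty using (⊥-elim)
open import Function using (_∘_)
open import Relation.Binary.PropositionalEquality
open +-*-Solver

Series : Set
Series = ℕ → ℕ

shift : Series → Series
shift f = f ∘ suc

δ : Series
δ zero    = 1
δ (suc _) = 0

θ : Series → Series
θ f i = i * f i

infixl 7 _⋆_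
infixr 8 _^⋆_

_⋆_ : Series → Series → Series
(f ⋆ g) zero    = f 0 * g 0
(f ⋆ g) (suc n) = f 0 * g (suc n) + (shift f ⋆ g) n

_^⋆_ : Series → ℕ → Series
f ^⋆ zero  = δ
f ^⋆ suc k = f ⋆ f ^⋆ k

⋆-as-sum : ∀ f g n → (f ⋆ g) n ≡ sum (applyUpTo (λ i → f i * g (n ∸ i)) (suc n))
⋆-as-sum f g zero    = sym (+-identityʳ (f 0 * g 0))
⋆-as-sum f g (suc n) = cong (f 0 * g (suc n) +_) (⋆-as-sum (shift f) g n)

⋆-cong : ∀ {f f′ g g′} → f ≗ f′ → g ≗ g′ → f ⋆ g ≗ f′ ⋆ g′
⋆-cong f≗f′ g≗g′ zero    = cong₂ _*_ (f≗f′ 0) (g≗g′ 0)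
⋆-cong f≗f′ g≗g′ (suc n) =
  cong₂ _+_ (cong₂ _*_ (f≗f′ 0) (g≗g′ (suc n))) (⋆-cong (f≗f′ ∘ suc) g≗g′ n)

⋆-unfoldʳ : ∀ f g n → (f ⋆ g) (suc n) ≡ (f ⋆ shift g) n + f (suc n) * g 0
⋆-unfoldʳ f g zero    = refl
⋆-unfoldʳ f g (suc n) = begin
  f 0 * g (suc (suc n)) + (shift f ⋆ g) (suc n)
    ≡⟨ cong (f 0 * g (suc (suc n)) +_) (⋆-unfoldʳ (shift f) g n) ⟩
  f 0 * g (suc (suc n)) + ((shift f ⋆ shift g) n + f (suc (suc n)) * g 0)
    ≡⟨ +-assoc (f 0 * g (suc (suc n))) _ _ ⟨
  f 0 * g (suc (suc n)) + (shift f ⋆ shift g) n + f (suc (suc n)) * g 0 ∎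
  where open ≡-Reasoning

⋆-comm : ∀ f g → f ⋆ g ≗ g ⋆ f
⋆-comm f g zero    = *-comm (f 0) (g 0)
⋆-comm f g (suc n) = begin
  f 0 * g (suc n) + (shift f ⋆ g) n
    ≡⟨ cong₂ _+_ (*-comm (f 0) (g (suc n))) (⋆-comm (shift f) g n) ⟩
  g (suc n) * f 0 + (g ⋆ shift f) n
    ≡⟨ +-comm (g (suc n) * f 0) _ ⟩
  (g ⋆ shift f) n + g (suc n) * f 0
    ≡⟨ ⋆-unfoldʳ g f n ⟨
  (g ⋆ f) (suc n) ∎
  where open ≡-Reasoning

⋆-distribʳ-+ : ∀ f f′ g → (λ i → f i + f′ i) ⋆ g ≗ λ n → (f ⋆ g) n + (f′ ⋆ g) n
⋆-distribʳ-+ f f′ g zero    = *-distribʳ-+ (g 0) (f 0) (f′ 0)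
⋆-distribʳ-+ f f′ g (suc n) = begin
  (f 0 + f′ 0) * g (suc n) + ((λ i → f (suc i) + f′ (suc i)) ⋆ g) n
    ≡⟨ cong₂ _+_ (*-distribʳ-+ (g (suc n)) (f 0) (f′ 0)) (⋆-distribʳ-+ (shift f) (shift f′) g n) ⟩
  (f 0 * g (suc n) + f′ 0 * g (suc n)) + ((shift f ⋆ g) n + (shift f′ ⋆ g) n)
    ≡⟨ +-interchange (f 0 * g (suc n)) (f′ 0 * g (suc n)) _ _ ⟩
  (f 0 * g (suc n) + (shift f ⋆ g) n) + (f′ 0 * g (suc n) + (shift f′ ⋆ g) n) ∎
  where open ≡-Reasoning

⋆-scaleˡ : ∀ c f g → (λ i → c * f i) ⋆ g ≗ λ n → c * (f ⋆ g) n
⋆-scaleˡ c f g zero    = *-assoc c (f 0) (g 0)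
⋆-scaleˡ c f g (suc n) = begin
  c * f 0 * g (suc n) + ((λ i → c * f (suc i)) ⋆ g) n
    ≡⟨ cong₂ _+_ (*-assoc c (f 0) (g (suc n))) (⋆-scaleˡ c (shift f) g n) ⟩
  c * (f 0 * g (suc n)) + c * (shift f ⋆ g) n
    ≡⟨ *-distribˡ-+ c _ _ ⟨
  c * (f 0 * g (suc n) + (shift f ⋆ g) n) ∎
  where open ≡-Reasoning

⋆-scaleʳ : ∀ c f g → f ⋆ (λ i → c * g i) ≗ λ n → c * (f ⋆ g) n
⋆-scaleʳ c f g n = begin
  (f ⋆ (λ i → c * g i)) n ≡⟨ ⋆-comm f _ n ⟩
  ((λ i → c * g i) ⋆ f) n ≡⟨ ⋆-scaleˡ c g f n ⟩
  c * (g ⋆ f) n           ≡⟨ cong (c *_) (⋆-comm g f n) ⟩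
  c * (f ⋆ g) n           ∎
  where open ≡-Reasoning

⋆-assoc : ∀ f g h → (f ⋆ g) ⋆ h ≗ f ⋆ (g ⋆ h)
⋆-assoc f g h zero    = *-assoc (f 0) (g 0) (h 0)
⋆-assoc f g h (suc n) = begin
  f 0 * g 0 * h (suc n) + (shift (f ⋆ g) ⋆ h) n
    ≡⟨ cong (f 0 * g 0 * h (suc n) +_) (⋆-distribʳ-+ (λ i → f 0 * g (suc i)) (shift f ⋆ g) h n) ⟩
  f 0 * g 0 * h (suc n) + (((λ i → f 0 * g (suc i)) ⋆ h) n + ((shift f ⋆ g) ⋆ h) n)
    ≡⟨ cong (f 0 * g 0 * h (suc n) +_)
         (cong₂ _+_ (⋆-scaleˡ (f 0) (shift g) h n) (⋆-assoc (shift f) g h n)) ⟩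
  f 0 * g 0 * h (suc n) + (f 0 * (shift g ⋆ h) n + (shift f ⋆ (g ⋆ h)) n)
    ≡⟨ regroup (f 0) (g 0) (h (suc n)) _ _ ⟩
  f 0 * (g 0 * h (suc n) + (shift g ⋆ h) n) + (shift f ⋆ (g ⋆ h)) n ∎
  where
  open ≡-Reasoning
  regroup : ∀ a b c d e → a * b * c + (a * d + e) ≡ a * (b * c + d) + e
  regroup = solve 5 (λ a b c d e → a :* b :* c :+ (a :* d :+ e) := a :* (b :* c :+ d) :+ e) refl

⋆-leftComm : ∀ f g h → f ⋆ (g ⋆ h) ≗ g ⋆ (f ⋆ h)
⋆-leftComm f g h n = begin
  (f ⋆ (g ⋆ h)) n ≡⟨ ⋆-assoc f g h n ⟨
  ((f ⋆ g) ⋆ h) n ≡⟨ ⋆-cong (⋆-comm f g) (λ _ → refl) n ⟩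
  ((g ⋆ f) ⋆ h) n ≡⟨ ⋆-assoc g f h n ⟩
  (g ⋆ (f ⋆ h)) n ∎
  where open ≡-Reasoning

θ-⋆ : ∀ f g → θ (f ⋆ g) ≗ λ n → (θ f ⋆ g) n + (f ⋆ θ g) n
θ-⋆ f g zero    = sym (*-zeroʳ (f 0))
θ-⋆ f g (suc n) = begin
  suc n * (f 0 * g (suc n) + (shift f ⋆ g) n)
    ≡⟨ expand n (f 0) (g (suc n)) _ ⟩
  f 0 * (suc n * g (suc n)) + ((shift f ⋆ g) n + n * (shift f ⋆ g) n)
    ≡⟨ cong (λ z → f 0 * (suc n * g (suc n)) + ((shift f ⋆ g) n + z)) (θ-⋆ (shift f) g n) ⟩
  f 0 * (suc n * g (suc n)) + ((shift f ⋆ g) n + ((θ (shift f) ⋆ g) n + (shift f ⋆ θ g) n))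
    ≡⟨ regroup (f 0 * (suc n * g (suc n))) ((shift f ⋆ g) n) ((θ (shift f) ⋆ g) n) ((shift f ⋆ θ g) n) ⟩
  ((θ (shift f) ⋆ g) n + (shift f ⋆ g) n) + (f 0 * (suc n * g (suc n)) + (shift f ⋆ θ g) n)
    ≡⟨ cong (_+ (f 0 * (suc n * g (suc n)) + (shift f ⋆ θ g) n)) shift-θ ⟩
  (shift (θ f) ⋆ g) n + (f 0 * (suc n * g (suc n)) + (shift f ⋆ θ g) n) ∎
  where
  open ≡-Reasoning
  expand : ∀ n a b c → suc n * (a * b + c) ≡ a * (suc n * b) + (c + n * c)
  expand = solve 4 (λ n a b c → (con 1 :+ n) :* (a :* b :+ c) := a :* ((con 1 :+ n) :* b) :+ (c :+ n :* c)) refl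
  regroup : ∀ a b c d → a + (b + (c + d)) ≡ (c + b) + (a + d)
  regroup = solve 4 (λ a b c d → a :+ (b :+ (c :+ d)) := (c :+ b) :+ (a :+ d)) refl
  shift-θ : (θ (shift f) ⋆ g) n + (shift f ⋆ g) n ≡ (shift (θ f) ⋆ g) n
  shift-θ = begin
    (θ (shift f) ⋆ g) n + (shift f ⋆ g) n  ≡⟨ ⋆-distribʳ-+ (θ (shift f)) (shift f) g n ⟨
    ((λ i → i * f (suc i) + f (suc i)) ⋆ g) n
      ≡⟨ ⋆-cong (λ i → +-comm (i * f (suc i)) (f (suc i))) (λ _ → refl) n ⟩
    (shift (θ f) ⋆ g) n                     ∎

θ-δ : θ δ ≗ λ _ → 0
θ-δ zero    = refl
θ-δ (suc i) = *-zeroʳ (suc i)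

θ-^⋆ : ∀ f k → θ (f ^⋆ suc k) ≗ λ n → suc k * (θ f ⋆ f ^⋆ k) n
θ-^⋆ f zero n = begin
  θ (f ⋆ δ) n                ≡⟨ θ-⋆ f δ n ⟩
  (θ f ⋆ δ) n + (f ⋆ θ δ) n  ≡⟨ cong ((θ f ⋆ δ) n +_) (⋆-cong (λ _ → refl) θ-δ n) ⟩
  (θ f ⋆ δ) n + (f ⋆ (λ i → 0 * δ i)) n
    ≡⟨ cong ((θ f ⋆ δ) n +_) (⋆-scaleʳ 0 f δ n) ⟩
  (θ f ⋆ δ) n + 0            ∎
  where open ≡-Reasoning
θ-^⋆ f (suc k) n = begin
  θ (f ⋆ f ^⋆ suc k) n
    ≡⟨ θ-⋆ f (f ^⋆ suc k) n ⟩
  (θ f ⋆ f ^⋆ suc k) n + (f ⋆ θ (f ^⋆ suc k)) n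
    ≡⟨ cong ((θ f ⋆ f ^⋆ suc k) n +_) (⋆-cong (λ _ → refl) (θ-^⋆ f k) n) ⟩
  (θ f ⋆ f ^⋆ suc k) n + (f ⋆ (λ i → suc k * (θ f ⋆ f ^⋆ k) i)) n
    ≡⟨ cong ((θ f ⋆ f ^⋆ suc k) n +_) (⋆-scaleʳ (suc k) f _ n) ⟩
  (θ f ⋆ f ^⋆ suc k) n + suc k * (f ⋆ (θ f ⋆ f ^⋆ k)) n
    ≡⟨ cong (λ z → (θ f ⋆ f ^⋆ suc k) n + suc k * z) (⋆-leftComm f (θ f) (f ^⋆ k) n) ⟩
  (θ f ⋆ f ^⋆ suc k) n + suc k * (θ f ⋆ f ^⋆ suc k) n ∎
  where open ≡-Reasoning

^⋆-index-∣ : ∀ f k n → suc k ∣ n * (f ^⋆ suc k) n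
^⋆-index-∣ f k n = divides ((θ f ⋆ f ^⋆ k) n) (trans (θ-^⋆ f k n) (*-comm (suc k) _))

T≗reg^⋆ : ∀ ℓ k → T ℓ k ≗ reg ℓ ^⋆ k
T≗reg^⋆ ℓ zero    zero    = refl
T≗reg^⋆ ℓ zero    (suc n) = refl
T≗reg^⋆ ℓ (suc k) n = begin
  T ℓ (suc k) n
    ≡⟨ cong sum (map-upTo (λ i → reg ℓ i * T ℓ k (n ∸ i)) (suc n)) ⟩
  sum (applyUpTo (λ i → reg ℓ i * T ℓ k (n ∸ i)) (suc n))
    ≡⟨ ⋆-as-sum (reg ℓ) (T ℓ k) n ⟨
  (reg ℓ ⋆ T ℓ k) n
    ≡⟨ ⋆-cong (λ _ → refl) (T≗reg^⋆ ℓ k) n ⟩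
  (reg ℓ ^⋆ suc k) n ∎
  where open ≡-Reasoning

prime-∣-cofactor : ∀ {p} n r x → Prime p → 1 ≤ r → r < p → p ∣ (p * n + r) * x → p ∣ x
prime-∣-cofactor {p} n r x pp 1≤r r<p p∣mx with euclidsLemma (p * n + r) x pp p∣mx
... | inj₂ p∣x = p∣x
... | inj₁ p∣m = ⊥-elim (>⇒∤ {{>-nonZero 1≤r}} r<p (∣m+n∣m⇒∣n p∣m (m∣m*n n)))

theorem1p1 : (p ℓ : ℕ) → Prime p → 2 ≤ ℓ → (n r : ℕ) → 1 ≤ r → r < p →
    p ∣ T ℓ p (p * n + r)
theorem1p1 zero    ℓ () _ n r 1≤r r<p
theorem1p1 (suc k) ℓ pp _ n r 1≤r r<p =
  prime-∣-cofactor n r (T ℓ (suc k) m) pp 1≤r r<p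
    (subst (λ t → suc k ∣ m * t) (sym (T≗reg^⋆ ℓ (suc k) m)) (^⋆-index-∣ (reg ℓ) k m))
  where m = suc k * n + r
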